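{- For all integers $n,r\geq 1$ and $1\leq i\leq n-2$, \[|\mathcal{I}^{(r)}_{p_i}(P_n^*)|=|\mathcal{I}^{(r)}_{p_i}(P_{n-1}^*)|+|\mathcal{I}^{(r-1)}_{p_i}(P_{n-1}^*)|+|\mathcal{I}^{(r-1)}_{p_i}(P_{n-2}^*)|+|\mathcal{I}^{(r-2)}_{p_i}(P_{n-2}^*)|.\]
   Context: For $m\geq 1$, $P_m$ is the path graph with vertices $x_1,\dots,x_m$ and edges $x_jx_{j+1}$ ($1\leq j\leq m-1$), and the pendant graph $P_m^*$ has vertex set $\{x_1,\dots,x_m\}\sqcup\{p_1,\dots,p_m\}$ and edge set $E(P_m)\sqcup\{x_1p_1,\dots,x_mp_m\}$; thus $P_{m-1}^*$ is the induced subgraph of $P_m^*$ on $\{x_1,p_1,\dots,x_{m-1},p_{m-1}\}$. For a graph $H$ and integer $s$, $\mathcal{I}^{(s)}(H)$ is the family of independent sets of size $s$ in $H$ (empty if $s<0$), and $\mathcal{I}^{(s)}_v(H)$ is the subfamily of those containing the vertex $v$. -}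

module Defs where

open import Data.Bool using (Bool; true; false; _∧_; not; T?)
open import Data.Nat using (ℕ; zero; suc; _+_)
open import Data.Fin using (Fin; zero; suc; inject₁)
open import Data.List using (List; []; _∷_; map; concatMap; filter; length; allFin; _++_)
open import Data.Vec using (Vec; []; _∷_; lookup)
open import Data.Product using (_×_; _,_)
open import Data.Sum using (_⊎_; inj₁; inj₂)
open import Data.Integer using (ℤ; +_)
open import Relation.Nullary.Decidable using (⌊_⌋)
import Data.Integer as ℤ

-- Vertices of the pendant graph P_m^* :
--   inj₁ j  is  x_{j+1}   and   inj₂ j  is  p_{j+1}   (j : Fin m, 0-based)
Vertex : ℕ → Set
Vertex m = Fin m ⊎ Fin m

pathEdges : (m : ℕ) → List (Fin m × Fin m)
pathEdges zero    = []
pathEdges (suc k) = map (λ j → inject₁ j , suc j) (allFin k)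

edges : (m : ℕ) → List (Vertex m × Vertex m)
edges m = map (λ { (a , b) → inj₁ a , inj₁ b }) (pathEdges m)
       ++ map (λ j → inj₁ j , inj₂ j) (allFin m)

-- A vertex subset of P_m^* : characteristic vectors of its x-part and p-part.
VSet : ℕ → Set
VSet m = Vec Bool m × Vec Bool m

_∈ᵇ_ : {m : ℕ} → Vertex m → VSet m → Bool
inj₁ j ∈ᵇ (X , P) = lookup X j
inj₂ j ∈ᵇ (X , P) = lookup P j

countTrue : {m : ℕ} → Vec Bool m → ℕ
countTrue []           = 0
countTrue (true  ∷ bs) = suc (countTrue bs)
countTrue (false ∷ bs) = countTrue bs

card : {m : ℕ} → VSet m → ℕ
card (X , P) = countTrue X + countTrue P

allᵇ : {A : Set} → (A → Bool) → List A → Bool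
allᵇ p []       = true
allᵇ p (x ∷ xs) = p x ∧ allᵇ p xs

independent : {m : ℕ} → VSet m → Bool
independent {m} S = allᵇ (λ { (u , v) → not ((u ∈ᵇ S) ∧ (v ∈ᵇ S)) }) (edges m)

-- S contains p_i (i is 1-based; false if p_i is not a vertex of P_m^*)
containsP : {m : ℕ} → ℕ → VSet m → Bool
containsP i (X , P) = go i P
  where
  go : {k : ℕ} → ℕ → Vec Bool k → Bool
  go zero          _        = false
  go (suc _)       []       = false
  go (suc zero)    (b ∷ _)  = b
  go (suc (suc j)) (_ ∷ bs) = go (suc j) bs

allVecs : (m : ℕ) → List (Vec Bool m)
allVecs zero    = [] ∷ []
allVecs (suc m) = concatMap (λ v → (true ∷ v) ∷ (false ∷ v) ∷ []) (allVecs m)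

allVSets : (m : ℕ) → List (VSet m)
allVSets m = concatMap (λ X → map (λ P → X , P) (allVecs m)) (allVecs m)

-- membership in I^{(s)}_{p_i}(P_m^*) : independent, of size s, containing p_i.
-- (s : ℤ ; for s < 0 no set qualifies, so the family is empty.)
inFamily : (m i : ℕ) (s : ℤ) → VSet m → Bool
inFamily m i s S = independent S ∧ (⌊ (+ card S) ℤ.≟ s ⌋ ∧ containsP i S)

numIndepP : (m i : ℕ) (s : ℤ) → ℕ
numIndepP m i s = length (filter (λ S → T? (inFamily m i s S)) (allVSets m))

{-# OPTIONS --safe #-}
module Submission where

-- An independent set of P_n^* never contains both x_n and p_n. If it contains neither, or
-- only p_n, removing them leaves an independent set of P_{n-1}^*; if it contains x_n, it
-- avoids x_{n-1} and p_n, and removing x_n and p_{n-1} (if present) leaves an independent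
-- set of P_{n-2}^*. Since i ≤ n - 2, the condition p_i ∈ S is untouched. Cardinalities are
-- computed as sums of indicators over all vertex subsets, split along the last coordinates.

open import Defs
open import Algebra.Bundles using (AbelianGroup; CommutativeMonoid)
import Algebra.Properties.CommutativeSemigroup as CommutativeSemigroupProperties
import Algebra.Properties.Group as GroupProperties
open import Data.Bool using (Bool; true; false; _∧_; not; T?)
open import Data.Bool.Properties using (∧-assoc; ∧-comm; ∧-identityʳ; ∧-commutativeMonoid)
open import Data.Fin using (Fin; zero; suc; inject₁)
open import Data.Integer using (ℤ; +_; _-_; _≟_)
import Data.Integer as ℤ
import Data.Integer.Properties as ℤ
open import Data.List using (List; []; _∷_; map; concatMap; filter; length; tabulate; allFin; _++_)
open import Data.List.Properties using (map-++; map-∘; map-cong)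
open import Data.Nat.ListAction using (sum)
open import Data.Nat.ListAction.Properties using (sum-++)
open import Data.Nat using (ℕ; zero; suc; _+_; _∸_; _≤_; s≤s)
open import Data.Nat.Properties using (+-identityʳ; +-comm; +-assoc; +-commutativeSemigroup; m≤n⇒m≤1+n)
open import Data.Product using (_×_; _,_; proj₁; proj₂)
open import Data.Vec using (Vec; []; _∷_; lookup; _∷ʳ_)
open import Function using (_∘_; _⇔_; mk⇔)
open import Relation.Binary.PropositionalEquality
  using (_≡_; refl; sym; trans; cong; cong₂; module ≡-Reasoning)
open import Relation.Nullary.Decidable using (⌊_⌋; isYes≗does; does-⇔)

open CommutativeSemigroupProperties +-commutativeSemigroup using (interchange)
open CommutativeSemigroupProperties (CommutativeMonoid.commutativeSemigroup ∧-commutativeMonoid)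
  using () renaming (interchange to ∧-interchange; xy∙z≈y∙xz to ∧-pull-middle)
open ≡-Reasoning

private variable
  A B : Set
  m i : ℕ

toℕ : Bool → ℕ
toℕ true  = 1
toℕ false = 0

sumBy : (A → ℕ) → List A → ℕ
sumBy f xs = sum (map f xs)

length-filter : (p : A → Bool) (xs : List A) →
  length (filter (λ x → T? (p x)) xs) ≡ sumBy (toℕ ∘ p) xs
length-filter p []       = refl
length-filter p (x ∷ xs) with p x
... | true  = cong suc (length-filter p xs)
... | false = length-filter p xs

sumBy-cong : {f g : A → ℕ} → (∀ x → f x ≡ g x) → (xs : List A) → sumBy f xs ≡ sumBy g xs
sumBy-cong f≗g xs = cong sum (map-cong f≗g xs)

sumBy-map : (f : B → ℕ) (g : A → B) (xs : List A) → sumBy f (map g xs) ≡ sumBy (f ∘ g) xs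
sumBy-map f g xs = cong sum (sym (map-∘ xs))

sumBy-++ : (f : A → ℕ) (xs ys : List A) → sumBy f (xs ++ ys) ≡ sumBy f xs + sumBy f ys
sumBy-++ f xs ys = trans (cong sum (map-++ f xs ys)) (sum-++ (map f xs) (map f ys))

sumBy-concatMap : (f : B → ℕ) (g : A → List B) (xs : List A) →
  sumBy f (concatMap g xs) ≡ sumBy (sumBy f ∘ g) xs
sumBy-concatMap f g []       = refl
sumBy-concatMap f g (x ∷ xs) =
  trans (sumBy-++ f (g x) (concatMap g xs)) (cong (_+_ (sumBy f (g x))) (sumBy-concatMap f g xs))

sumBy-+ : (f g : A → ℕ) (xs : List A) → sumBy (λ x → f x + g x) xs ≡ sumBy f xs + sumBy g xs
sumBy-+ f g []       = refl
sumBy-+ f g (x ∷ xs) =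
  trans (cong (_+_ (f x + g x)) (sumBy-+ f g xs)) (interchange (f x) (g x) (sumBy f xs) (sumBy g xs))

sumBy-zero : (xs : List A) → sumBy (λ _ → 0) xs ≡ 0
sumBy-zero []       = refl
sumBy-zero (x ∷ xs) = sumBy-zero xs

sumBool : (Bool → ℕ) → ℕ
sumBool f = f false + f true

sumBool-cong : {f g : Bool → ℕ} → (∀ a → f a ≡ g a) → sumBool f ≡ sumBool g
sumBool-cong f≗g = cong₂ _+_ (f≗g false) (f≗g true)

sumBool-swap : (f : Bool → Bool → ℕ) →
  sumBool (λ a → sumBool (f a)) ≡ sumBool (λ b → sumBool (λ a → f a b))
sumBool-swap f = interchange (f false false) (f false true) (f true false) (f true true)

∑Vec : (m : ℕ) → (Vec Bool m → ℕ) → ℕ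
∑Vec m h = sumBy h (allVecs m)

∑Vec-cong : {h h′ : Vec Bool m → ℕ} → (∀ v → h v ≡ h′ v) → ∑Vec m h ≡ ∑Vec m h′
∑Vec-cong {m} h≗h′ = sumBy-cong h≗h′ (allVecs m)

∑Vec-sumBool : (f : Vec Bool m → Bool → ℕ) →
  ∑Vec m (λ v → sumBool (f v)) ≡ sumBool (λ a → ∑Vec m (λ v → f v a))
∑Vec-sumBool {m} f = sumBy-+ (λ v → f v false) (λ v → f v true) (allVecs m)

∑Vec-∷ : (h : Vec Bool (suc m) → ℕ) → ∑Vec (suc m) h ≡ sumBool (λ a → ∑Vec m (h ∘ (a ∷_)))
∑Vec-∷ {m} h = begin
  ∑Vec (suc m) h
    ≡⟨ sumBy-concatMap h (λ v → (true ∷ v) ∷ (false ∷ v) ∷ []) (allVecs m) ⟩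
  ∑Vec m (λ v → h (true ∷ v) + (h (false ∷ v) + 0))
    ≡⟨ ∑Vec-cong {m} (λ v → trans (cong (_+_ (h (true ∷ v))) (+-identityʳ _)) (+-comm (h (true ∷ v)) (h (false ∷ v)))) ⟩
  ∑Vec m (λ v → sumBool (λ a → h (a ∷ v)))
    ≡⟨ ∑Vec-sumBool (λ v a → h (a ∷ v)) ⟩
  sumBool (λ a → ∑Vec m (h ∘ (a ∷_))) ∎

∑Vec-∷ʳ : (m : ℕ) (h : Vec Bool (suc m) → ℕ) →
  ∑Vec (suc m) h ≡ sumBool (λ a → ∑Vec m (λ v → h (v ∷ʳ a)))
∑Vec-∷ʳ zero    h = ∑Vec-∷ h
∑Vec-∷ʳ (suc m) h = begin
  ∑Vec (suc (suc m)) h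
    ≡⟨ ∑Vec-∷ h ⟩
  sumBool (λ a → ∑Vec (suc m) (h ∘ (a ∷_)))
    ≡⟨ sumBool-cong (λ a → ∑Vec-∷ʳ m (h ∘ (a ∷_))) ⟩
  sumBool (λ a → sumBool (λ b → ∑Vec m (λ v → h (a ∷ (v ∷ʳ b)))))
    ≡⟨ sumBool-swap (λ a b → ∑Vec m (λ v → h (a ∷ (v ∷ʳ b)))) ⟩
  sumBool (λ b → sumBool (λ a → ∑Vec m (λ v → h (a ∷ (v ∷ʳ b)))))
    ≡⟨ sumBool-cong (λ b → sym (∑Vec-∷ (λ v → h (v ∷ʳ b)))) ⟩
  sumBool (λ b → ∑Vec (suc m) (λ v → h (v ∷ʳ b))) ∎

∑VSet : (m : ℕ) → (VSet m → ℕ) → ℕ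
∑VSet m h = ∑Vec m (λ X → ∑Vec m (λ P → h (X , P)))

∑VSet-cong : {h h′ : VSet m → ℕ} → (∀ S → h S ≡ h′ S) → ∑VSet m h ≡ ∑VSet m h′
∑VSet-cong {m} h≗h′ = ∑Vec-cong {m} (λ X → ∑Vec-cong {m} (λ P → h≗h′ (X , P)))

∑VSet-zero : (m : ℕ) → ∑VSet m (λ _ → 0) ≡ 0
∑VSet-zero m = trans (∑Vec-cong {m} (λ _ → sumBy-zero (allVecs m))) (sumBy-zero (allVecs m))

sumBy-allVSets : (h : VSet m → ℕ) → sumBy h (allVSets m) ≡ ∑VSet m h
sumBy-allVSets {m} h =
  trans (sumBy-concatMap h (λ X → map (X ,_) (allVecs m)) (allVecs m))
        (∑Vec-cong {m} (λ X → sumBy-map h (X ,_) (allVecs m)))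

extend : VSet m → Bool → Bool → VSet (suc m)
extend (X , P) a b = X ∷ʳ a , P ∷ʳ b

∑VSet-extend : (h : VSet (suc m) → ℕ) →
  ∑VSet (suc m) h ≡ sumBool (λ a → sumBool (λ b → ∑VSet m (λ S → h (extend S a b))))
∑VSet-extend {m} h = begin
  ∑Vec (suc m) (λ X → ∑Vec (suc m) (λ P → h (X , P)))
    ≡⟨ ∑Vec-∷ʳ m _ ⟩
  sumBool (λ a → ∑Vec m (λ X → ∑Vec (suc m) (λ P → h (X ∷ʳ a , P))))
    ≡⟨ sumBool-cong (λ a → ∑Vec-cong {m} (λ X → ∑Vec-∷ʳ m (λ P → h (X ∷ʳ a , P)))) ⟩
  sumBool (λ a → ∑Vec m (λ X → sumBool (λ b → ∑Vec m (λ P → h (X ∷ʳ a , P ∷ʳ b)))))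
    ≡⟨ sumBool-cong (λ a → ∑Vec-sumBool {m} (λ X b → ∑Vec m (λ P → h (X ∷ʳ a , P ∷ʳ b)))) ⟩
  sumBool (λ a → sumBool (λ b → ∑VSet m (λ S → h (extend S a b)))) ∎

allᵇ-++ : (p : A → Bool) (xs ys : List A) → allᵇ p (xs ++ ys) ≡ allᵇ p xs ∧ allᵇ p ys
allᵇ-++ p []       ys = refl
allᵇ-++ p (x ∷ xs) ys = trans (cong (p x ∧_) (allᵇ-++ p xs ys)) (sym (∧-assoc (p x) _ _))

allᵇ-map : (p : B → Bool) (g : A → B) (xs : List A) → allᵇ p (map g xs) ≡ allᵇ (p ∘ g) xs
allᵇ-map p g []       = refl
allᵇ-map p g (x ∷ xs) = cong (p (g x) ∧_) (allᵇ-map p g xs)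

allFinᵇ : (Fin m → Bool) → Bool
allFinᵇ {zero}  h = true
allFinᵇ {suc m} h = h zero ∧ allFinᵇ (h ∘ suc)

allᵇ-tabulate : (p : A → Bool) (f : Fin m → A) → allᵇ p (tabulate f) ≡ allFinᵇ (p ∘ f)
allᵇ-tabulate {m = zero}  p f = refl
allᵇ-tabulate {m = suc m} p f = cong (p (f zero) ∧_) (allᵇ-tabulate p (f ∘ suc))

noAdjacent : Vec Bool m → Bool
noAdjacent []          = true
noAdjacent (x ∷ [])    = true
noAdjacent (x ∷ y ∷ X) = not (x ∧ y) ∧ noAdjacent (y ∷ X)

disjoint : Vec Bool m → Vec Bool m → Bool
disjoint []      []      = true
disjoint (x ∷ X) (p ∷ P) = not (x ∧ p) ∧ disjoint X P

allFinᵇ-noAdjacent : (X : Vec Bool (suc m)) →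
  allFinᵇ (λ j → not (lookup X (inject₁ j) ∧ lookup X (suc j))) ≡ noAdjacent X
allFinᵇ-noAdjacent (x ∷ [])    = refl
allFinᵇ-noAdjacent (x ∷ y ∷ X) = cong (not (x ∧ y) ∧_) (allFinᵇ-noAdjacent (y ∷ X))

allFinᵇ-disjoint : (X P : Vec Bool m) → allFinᵇ (λ j → not (lookup X j ∧ lookup P j)) ≡ disjoint X P
allFinᵇ-disjoint []      []      = refl
allFinᵇ-disjoint (x ∷ X) (p ∷ P) = cong (not (x ∧ p) ∧_) (allFinᵇ-disjoint X P)

allᵇ-pathEdges : (X : Vec Bool m) →
  allᵇ (λ e → not (lookup X (proj₁ e) ∧ lookup X (proj₂ e))) (pathEdges m) ≡ noAdjacent X
allᵇ-pathEdges []      = refl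
allᵇ-pathEdges {suc m} X =
  trans (allᵇ-map edgeFree (λ j → inject₁ j , suc j) (allFin m))
        (trans (allᵇ-tabulate (edgeFree ∘ (λ j → inject₁ j , suc j)) (λ j → j)) (allFinᵇ-noAdjacent X))
  where edgeFree = λ (e : Fin (suc m) × Fin (suc m)) → not (lookup X (proj₁ e) ∧ lookup X (proj₂ e))

independent-≡ : (X P : Vec Bool m) → independent (X , P) ≡ noAdjacent X ∧ disjoint X P
independent-≡ {m} X P =
  trans (allᵇ-++ _ (map _ (pathEdges m)) (map _ (allFin m)))
        (cong₂ _∧_ (trans (allᵇ-map _ _ (pathEdges m)) (allᵇ-pathEdges X))
                   (trans (allᵇ-map _ _ (allFin m))
                          (trans (allᵇ-tabulate (λ j → not (lookup X j ∧ lookup P j)) (λ j → j))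
                                 (allFinᵇ-disjoint X P))))

-- The last entry; false for the empty vector, matching the absence of x_0.
lastᵇ : Vec Bool m → Bool
lastᵇ []          = false
lastᵇ (x ∷ [])    = x
lastᵇ (_ ∷ y ∷ X) = lastᵇ (y ∷ X)

lastᵇ-∷ʳ : (X : Vec Bool m) (a : Bool) → lastᵇ (X ∷ʳ a) ≡ a
lastᵇ-∷ʳ []          a = refl
lastᵇ-∷ʳ (x ∷ [])    a = refl
lastᵇ-∷ʳ (x ∷ y ∷ X) a = lastᵇ-∷ʳ (y ∷ X) a

noAdjacent-∷ʳ : (X : Vec Bool m) (a : Bool) → noAdjacent (X ∷ʳ a) ≡ noAdjacent X ∧ not (a ∧ lastᵇ X)
noAdjacent-∷ʳ []          true  = refl
noAdjacent-∷ʳ []          false = refl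
noAdjacent-∷ʳ (x ∷ [])    a     = trans (∧-identityʳ _) (cong not (∧-comm x a))
noAdjacent-∷ʳ (x ∷ y ∷ X) a     =
  trans (cong (not (x ∧ y) ∧_) (noAdjacent-∷ʳ (y ∷ X) a)) (sym (∧-assoc (not (x ∧ y)) _ _))

disjoint-∷ʳ : (X P : Vec Bool m) (a b : Bool) → disjoint (X ∷ʳ a) (P ∷ʳ b) ≡ disjoint X P ∧ not (a ∧ b)
disjoint-∷ʳ []      []      a b = ∧-identityʳ _
disjoint-∷ʳ (x ∷ X) (p ∷ P) a b =
  trans (cong (not (x ∧ p) ∧_) (disjoint-∷ʳ X P a b)) (sym (∧-assoc (not (x ∧ p)) _ _))

xLast : VSet m → Bool
xLast S = lastᵇ (proj₁ S)

xLast-extend : (S : VSet m) (a b : Bool) → xLast (extend S a b) ≡ a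
xLast-extend (X , P) a b = lastᵇ-∷ʳ X a

extendable : VSet m → Bool → Bool → Bool
extendable S a b = not (a ∧ b) ∧ not (a ∧ xLast S)

independent-extend : (S : VSet m) (a b : Bool) →
  independent (extend S a b) ≡ independent S ∧ extendable S a b
independent-extend (X , P) a b = begin
  independent (X ∷ʳ a , P ∷ʳ b)
    ≡⟨ independent-≡ (X ∷ʳ a) (P ∷ʳ b) ⟩
  noAdjacent (X ∷ʳ a) ∧ disjoint (X ∷ʳ a) (P ∷ʳ b)
    ≡⟨ cong₂ _∧_ (noAdjacent-∷ʳ X a) (disjoint-∷ʳ X P a b) ⟩
  (noAdjacent X ∧ not (a ∧ lastᵇ X)) ∧ (disjoint X P ∧ not (a ∧ b))
    ≡⟨ ∧-interchange (noAdjacent X) _ (disjoint X P) _ ⟩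
  (noAdjacent X ∧ disjoint X P) ∧ (not (a ∧ lastᵇ X) ∧ not (a ∧ b))
    ≡⟨ cong₂ _∧_ (sym (independent-≡ X P)) (∧-comm (not (a ∧ lastᵇ X)) _) ⟩
  independent (X , P) ∧ extendable (X , P) a b ∎

atPosition : ℕ → Vec Bool m → Bool
atPosition zero          _        = false
atPosition (suc _)       []       = false
atPosition (suc zero)    (b ∷ _)  = b
atPosition (suc (suc j)) (_ ∷ bs) = atPosition (suc j) bs

containsP-≡ : (i : ℕ) (X P : Vec Bool m) → containsP i (X , P) ≡ atPosition i P
containsP-≡ zero          X       P       = refl
containsP-≡ (suc i)       X       []      = refl
containsP-≡ (suc zero)    X       (b ∷ P) = refl
containsP-≡ (suc (suc j)) (x ∷ X) (b ∷ P) = containsP-≡ (suc j) X P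

atPosition-∷ʳ : (P : Vec Bool m) (b : Bool) → i ≤ m → atPosition i (P ∷ʳ b) ≡ atPosition i P
atPosition-∷ʳ {i = zero}        P       b _         = refl
atPosition-∷ʳ {i = suc zero}    (p ∷ P) b _         = refl
atPosition-∷ʳ {i = suc (suc j)} (p ∷ P) b (s≤s i≤m) = atPosition-∷ʳ P b i≤m

containsP-extend : (S : VSet m) (a b : Bool) → i ≤ m → containsP i (extend S a b) ≡ containsP i S
containsP-extend {i = i} (X , P) a b i≤m = begin
  containsP i (X ∷ʳ a , P ∷ʳ b) ≡⟨ containsP-≡ i (X ∷ʳ a) (P ∷ʳ b) ⟩
  atPosition i (P ∷ʳ b)         ≡⟨ atPosition-∷ʳ P b i≤m ⟩
  atPosition i P                ≡⟨ containsP-≡ i X P ⟨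
  containsP i (X , P)           ∎

countTrue-∷ʳ : (X : Vec Bool m) (a : Bool) → countTrue (X ∷ʳ a) ≡ countTrue X + toℕ a
countTrue-∷ʳ []          true  = refl
countTrue-∷ʳ []          false = refl
countTrue-∷ʳ (true  ∷ X) a     = cong suc (countTrue-∷ʳ X a)
countTrue-∷ʳ (false ∷ X) a     = countTrue-∷ʳ X a

card-extend : (S : VSet m) (a b : Bool) → card (extend S a b) ≡ card S + toℕ a + toℕ b
card-extend (X , P) a b = begin
  countTrue (X ∷ʳ a) + countTrue (P ∷ʳ b)
    ≡⟨ cong₂ _+_ (countTrue-∷ʳ X a) (countTrue-∷ʳ P b) ⟩
  countTrue X + toℕ a + (countTrue P + toℕ b)
    ≡⟨ interchange (countTrue X) (toℕ a) (countTrue P) (toℕ b) ⟩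
  countTrue X + countTrue P + (toℕ a + toℕ b)
    ≡⟨ +-assoc (countTrue X + countTrue P) (toℕ a) (toℕ b) ⟨
  countTrue X + countTrue P + toℕ a + toℕ b ∎

_-ᵇ_ : ℤ → Bool → ℤ
s -ᵇ true  = s - + 1
s -ᵇ false = s

+≡⇔≡- : (x y s : ℤ) → x ℤ.+ y ≡ s ⇔ x ≡ s - y
+≡⇔≡- x y s = mk⇔ (λ { refl → sym (//-rightDividesʳ y x) }) (λ { refl → //-rightDividesˡ y s })
  where open GroupProperties (AbelianGroup.group ℤ.+-0-abelianGroup)

≟-+toℕ : (c : ℕ) (a : Bool) (s : ℤ) → ⌊ + (c + toℕ a) ≟ s ⌋ ≡ ⌊ + c ≟ s -ᵇ a ⌋
≟-+toℕ c false s = cong (λ n → ⌊ + n ≟ s ⌋) (+-identityʳ c)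
≟-+toℕ c true  s = begin
  ⌊ + (c + 1) ≟ s ⌋       ≡⟨ isYes≗does (+ (c + 1) ≟ s) ⟩
  _                        ≡⟨ does-⇔ (+≡⇔≡- (+ c) (+ 1) s) (+ (c + 1) ≟ s) (+ c ≟ s - + 1) ⟩
  _                        ≡⟨ isYes≗does (+ c ≟ s - + 1) ⟨
  ⌊ + c ≟ s - + 1 ⌋       ∎

hasSize-extend : (S : VSet m) (a b : Bool) (s : ℤ) →
  ⌊ + card (extend S a b) ≟ s ⌋ ≡ ⌊ + card S ≟ (s -ᵇ b) -ᵇ a ⌋
hasSize-extend S a b s = begin
  ⌊ + card (extend S a b) ≟ s ⌋         ≡⟨ cong (λ n → ⌊ + n ≟ s ⌋) (card-extend S a b) ⟩
  ⌊ + (card S + toℕ a + toℕ b) ≟ s ⌋    ≡⟨ ≟-+toℕ (card S + toℕ a) b s ⟩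
  ⌊ + (card S + toℕ a) ≟ s -ᵇ b ⌋       ≡⟨ ≟-+toℕ (card S) a (s -ᵇ b) ⟩
  ⌊ + card S ≟ (s -ᵇ b) -ᵇ a ⌋          ∎

inFamily-extend : (s : ℤ) (S : VSet m) (a b : Bool) → i ≤ m →
  inFamily (suc m) i s (extend S a b) ≡ extendable S a b ∧ inFamily m i ((s -ᵇ b) -ᵇ a) S
inFamily-extend s S a b i≤m =
  trans (cong₂ _∧_ (independent-extend S a b)
                   (cong₂ _∧_ (hasSize-extend S a b s) (containsP-extend S a b i≤m)))
        (∧-pull-middle (independent S) (extendable S a b) _)

numIndepPWhere : (m i : ℕ) (s : ℤ) → (VSet m → Bool) → ℕ
numIndepPWhere m i s q = ∑VSet m (λ S → toℕ (q S ∧ inFamily m i s S))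

numIndepPWhere-cong : {s : ℤ} {q q′ : VSet m → Bool} → (∀ S → q S ≡ q′ S) →
  numIndepPWhere m i s q ≡ numIndepPWhere m i s q′
numIndepPWhere-cong {m} {i} {s} q≗q′ = ∑VSet-cong {m} (λ S → cong (λ c → toℕ (c ∧ inFamily m i s S)) (q≗q′ S))

numIndepP-≡ : (m i : ℕ) (s : ℤ) → numIndepP m i s ≡ numIndepPWhere m i s (λ _ → true)
numIndepP-≡ m i s = trans (length-filter (inFamily m i s) (allVSets m)) (sumBy-allVSets {m} (λ S → toℕ (inFamily m i s S)))

numIndepPWhere-extend : (s : ℤ) (q : VSet (suc m) → Bool) → i ≤ m →
  numIndepPWhere (suc m) i s q
    ≡ sumBool (λ a → sumBool (λ b →
        numIndepPWhere m i ((s -ᵇ b) -ᵇ a) (λ S → q (extend S a b) ∧ extendable S a b)))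
numIndepPWhere-extend {m} {i} s q i≤m =
  trans (∑VSet-extend (λ S → toℕ (q S ∧ inFamily (suc m) i s S)))
        (sumBool-cong λ a → sumBool-cong λ b → ∑VSet-cong {m} λ S → cong toℕ
          (trans (cong (q (extend S a b) ∧_) (inFamily-extend s S a b i≤m))
                 (sym (∧-assoc (q (extend S a b)) (extendable S a b) (inFamily m i ((s -ᵇ b) -ᵇ a) S)))))

-- The terms count the sets meeting {x_{m+1}, p_{m+1}} in ∅, in {p_{m+1}}, and in {x_{m+1}};
-- the last ones avoid x_m.
numIndepP-suc : (s : ℤ) → i ≤ m →
  numIndepP (suc m) i s
    ≡ numIndepP m i s + numIndepP m i (s - + 1) + numIndepPWhere m i (s - + 1) (not ∘ xLast)
numIndepP-suc {i} {m} s i≤m = begin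
  numIndepP (suc m) i s
    ≡⟨ numIndepP-≡ (suc m) i s ⟩
  numIndepPWhere (suc m) i s (λ _ → true)
    ≡⟨ numIndepPWhere-extend s (λ _ → true) i≤m ⟩
  numIndepPWhere m i s (λ _ → true) + numIndepPWhere m i (s - + 1) (λ _ → true)
    + (numIndepPWhere m i (s - + 1) (not ∘ xLast) + ∑VSet m (λ _ → 0))
    ≡⟨ cong₂ _+_ (sym (cong₂ _+_ (numIndepP-≡ m i s) (numIndepP-≡ m i (s - + 1))))
                 (trans (cong (_+_ _) (∑VSet-zero m)) (+-identityʳ _)) ⟩
  numIndepP m i s + numIndepP m i (s - + 1) + numIndepPWhere m i (s - + 1) (not ∘ xLast) ∎

numIndepPWhere-notLast-suc : (s : ℤ) → i ≤ m →
  numIndepPWhere (suc m) i s (not ∘ xLast) ≡ numIndepP m i s + numIndepP m i (s - + 1)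
numIndepPWhere-notLast-suc {i} {m} s i≤m = begin
  numIndepPWhere (suc m) i s (not ∘ xLast)
    ≡⟨ numIndepPWhere-extend s (not ∘ xLast) i≤m ⟩
  sumBool (λ a → sumBool (λ b →
    numIndepPWhere m i ((s -ᵇ b) -ᵇ a) (λ S → not (xLast (extend S a b)) ∧ extendable S a b)))
    ≡⟨ sumBool-cong (λ a → sumBool-cong (λ b → numIndepPWhere-cong {m} {i} {(s -ᵇ b) -ᵇ a} (λ S →
         cong (λ c → not c ∧ extendable S a b) (xLast-extend S a b)))) ⟩
  numIndepPWhere m i s (λ _ → true) + numIndepPWhere m i (s - + 1) (λ _ → true)
    + (∑VSet m (λ _ → 0) + ∑VSet m (λ _ → 0))
    ≡⟨ cong₂ _+_ (sym (cong₂ _+_ (numIndepP-≡ m i s) (numIndepP-≡ m i (s - + 1))))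
                 (cong₂ _+_ (∑VSet-zero m) (∑VSet-zero m)) ⟩
  numIndepP m i s + numIndepP m i (s - + 1) + 0
    ≡⟨ +-identityʳ _ ⟩
  numIndepP m i s + numIndepP m i (s - + 1) ∎

lemma4 : (n r i : ℕ) → 1 ≤ n → 1 ≤ r → 1 ≤ i → i ≤ n ∸ 2 →
    numIndepP n i (+ r)
      ≡ numIndepP (n ∸ 1) i (+ r) + numIndepP (n ∸ 1) i (+ r - + 1)
        + numIndepP (n ∸ 2) i (+ r - + 1) + numIndepP (n ∸ 2) i (+ r - + 2)
lemma4 (suc (suc m)) r i _ _ _ i≤m = begin
  numIndepP (suc (suc m)) i (+ r)
    ≡⟨ numIndepP-suc (+ r) (m≤n⇒m≤1+n i≤m) ⟩
  N₁ (+ r) + N₁ (+ r - + 1) + numIndepPWhere (suc m) i (+ r - + 1) (not ∘ xLast)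
    ≡⟨ cong (_+_ _) (numIndepPWhere-notLast-suc (+ r - + 1) i≤m) ⟩
  N₁ (+ r) + N₁ (+ r - + 1) + (N₀ (+ r - + 1) + N₀ (+ r - + 1 - + 1))
    ≡⟨ +-assoc (N₁ (+ r) + N₁ (+ r - + 1)) (N₀ (+ r - + 1)) _ ⟨
  N₁ (+ r) + N₁ (+ r - + 1) + N₀ (+ r - + 1) + N₀ (+ r - + 1 - + 1)
    ≡⟨ cong (_+_ (N₁ (+ r) + N₁ (+ r - + 1) + N₀ (+ r - + 1)) ∘ N₀) (ℤ.+-assoc (+ r) (ℤ.- + 1) (ℤ.- + 1)) ⟩
  N₁ (+ r) + N₁ (+ r - + 1) + N₀ (+ r - + 1) + N₀ (+ r - + 2) ∎
  where
  N₀ N₁ : ℤ → ℕ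
  N₀ = numIndepP m i
  N₁ = numIndepP (suc m) i
lemma4 1 _ (suc _) _ _ _ ()
lemma4 0 _ (suc _) _ _ _ ()
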